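{- Let $\mathcal D$ be a Ferrers diagram and $d$ a positive integer. Then $\nu_{\min}(\mathcal D,d)=0$ if and only if $\mathcal D\not\supseteq\mathcal T_d$. In particular, if $\mathcal D\ne\emptyset$ and the pair $(\mathcal D,d)$ is irreducible, then $\mathcal D\supseteq\mathcal T_d$.
   Context: A Ferrers diagram is a finite $\mathcal D\subseteq\mathbb N^2$ ($\mathbb N=\{1,2,\dots\}$) with $(x,y)\in\mathcal D\Rightarrow(i,j)\in\mathcal D$ for all $1\le i\le x$, $1\le j\le y$ (row, column). $\mathcal T_d=\{(i,j)\in\mathbb N^2:i+j\le d+1\}$ (column heights $(d,d-1,\dots,1)$). $\nu_j(\mathcal D,d)=|\{(x,y)\in\mathcal D:x\ge d-j,\ y\ge j+1\}|$ for $0\le j\le d-1$, $\nu_{\min}(\mathcal D,d)=\min_j\nu_j(\mathcal D,d)$. For $P\in\mathcal D$ such that $\mathcal D'=\mathcal D\setminus\{P\}$ is a Ferrers diagram: if $\nu_{\min}(\mathcal D',d)=\nu_{\min}(\mathcal D,d)$ write $\mathcal D'\xrightarrow{d}\mathcal D$, otherwise $\mathcal D\xrightarrow{d}\mathcal D'$. $(\mathcal D,d)$ is irreducible if there is no Ferrers diagram $\mathcal D'$ with $\mathcal D'\xrightarrow{d}\mathcal D$. -}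

module Defs where

open import Data.Nat using (ℕ; zero; suc; _+_; _∸_; _≤_; _≤ᵇ_; _⊓_)
open import Data.Nat.Properties using ()
open import Data.Bool using (Bool; true; false; _∧_; not; if_then_else_)
open import Data.Product using (Σ; _×_; _,_)
open import Relation.Binary.PropositionalEquality using (_≡_)
open import Relation.Nullary using (¬_)
open import Data.Nat using (_≡ᵇ_)

-- A subset of ℕ² (ℕ = {1,2,...}) given by its (decidable) membership
-- function; (x , y) = (row , column).  Only x , y ≥ 1 can be members.
Pred² : Set
Pred² = ℕ → ℕ → Bool

record IsFerrers (mem : Pred²) (bound : ℕ) : Set where
  field
    positive : ∀ x y → mem x y ≡ true → (1 ≤ x) × (1 ≤ y)
    bounded  : ∀ x y → mem x y ≡ true → (x ≤ bound) × (y ≤ bound)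
    downward : ∀ x y i j → mem x y ≡ true →
               1 ≤ i → i ≤ x → 1 ≤ j → j ≤ y → mem i j ≡ true

record Ferrers : Set where
  field
    mem       : Pred²
    bound     : ℕ
    isFerrers : IsFerrers mem bound
open Ferrers public

indicator : Bool → ℕ
indicator true  = 1
indicator false = 0

countTo : ℕ → (ℕ → Bool) → ℕ
countTo zero    p = 0
countTo (suc n) p = countTo n p + indicator (p (suc n))

sumTo : ℕ → (ℕ → ℕ) → ℕ
sumTo zero    f = 0
sumTo (suc n) f = sumTo n f + f (suc n)

count² : ℕ → Pred² → ℕ
count² B p = sumTo B (λ x → countTo B (λ y → p x y))

-- ν_j(D,d) = |{(x,y) ∈ D : x ≥ d - j , y ≥ j + 1}|
-- (every point of D lies in the box [1,bound D]², so counting in that box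
--  counts all of D)
ν : Ferrers → ℕ → ℕ → ℕ
ν D d j = count² (bound D)
  (λ x y → mem D x y ∧ ((d ∸ j) ≤ᵇ x) ∧ ((j + 1) ≤ᵇ y))

minUpTo : ℕ → (ℕ → ℕ) → ℕ
minUpTo zero    f = f 0
minUpTo (suc n) f = minUpTo n f ⊓ f (suc n)

-- ν_min(D,d) = min_{0 ≤ j ≤ d-1} ν_j(D,d)   (used for d ≥ 1)
νmin : Ferrers → ℕ → ℕ
νmin D d = minUpTo (d ∸ 1) (ν D d)

TriangleSub : ℕ → Ferrers → Set
TriangleSub d D = ∀ i j → 1 ≤ i → 1 ≤ j → i + j ≤ d + 1 → mem D i j ≡ true

IsRemoval : Ferrers → Ferrers → ℕ → ℕ → Set
IsRemoval D' D x y =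
  mem D x y ≡ true ×
  (∀ a b → mem D' a b ≡ (mem D a b ∧ not ((a ≡ᵇ x) ∧ (b ≡ᵇ y))))

Arrow : ℕ → Ferrers → Ferrers → Set
Arrow d D' D = Σ ℕ λ x → Σ ℕ λ y → IsRemoval D' D x y × (νmin D' d ≡ νmin D d)

Irreducible : Ferrers → ℕ → Set
Irreducible D d = ¬ (Σ Ferrers λ D' → Arrow d D' D)

NonEmpty : Ferrers → Set
NonEmpty D = Σ ℕ λ x → Σ ℕ λ y → mem D x y ≡ true

-- The number ν_j(D,d) counts the points of D dominating the
-- hypotenuse point (d - j, j + 1) of T_d.  Since D is down-closed, ν_j
-- vanishes exactly when that point is missing from D, and T_d ⊆ D exactly
-- when every hypotenuse point lies in D; so ν_min = 0 iff T_d ⊈ D.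
-- Removing a corner of D can only decrease every ν_j, so if ν_min(D,d) = 0
-- and D ≠ ∅, deleting a corner gives D' →d D and (D,d) is not irreducible.
module Submission where

open import Defs
open import Data.Bool using (Bool; true; false; _∧_; not)
open import Data.Bool.Properties using (∧-conicalˡ; ∧-conicalʳ; ∧-zeroʳ; ¬-not; not-¬; T-≡)
open import Data.Nat using (ℕ; zero; suc; _+_; _∸_; _≤_; _<_; _≤ᵇ_; _≡ᵇ_; z≤n; s≤s; s≤s⁻¹; _≟_)
open import Data.Nat.Properties
open import Data.Product using (Σ; _×_; _,_; proj₁; proj₂)
open import Data.Sum using (inj₁; inj₂)
open import Function.Bundles using (_⇔_; mk⇔; Equivalence)
open import Relation.Binary.PropositionalEquality
open import Relation.Nullary using (¬_; yes; no; contradiction)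

open Equivalence using (to; from)

≤⇒≤ᵇ≡true : ∀ {m n} → m ≤ n → (m ≤ᵇ n) ≡ true
≤⇒≤ᵇ≡true m≤n = to T-≡ (≤⇒≤ᵇ m≤n)

≤ᵇ≡true⇒≤ : ∀ {m n} → (m ≤ᵇ n) ≡ true → m ≤ n
≤ᵇ≡true⇒≤ eq = ≤ᵇ⇒≤ _ _ (from T-≡ eq)

≡ᵇ-refl : ∀ n → (n ≡ᵇ n) ≡ true
≡ᵇ-refl n = to T-≡ (≡⇒≡ᵇ n n refl)

countTo-zero : ∀ n (p : ℕ → Bool) → (∀ y → p y ≡ false) → countTo n p ≡ 0
countTo-zero zero    p none = refl
countTo-zero (suc n) p none rewrite none (suc n) | countTo-zero n p none = refl

sumTo-zero : ∀ n f → (∀ x → f x ≡ 0) → sumTo n f ≡ 0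
sumTo-zero zero    f zeros = refl
sumTo-zero (suc n) f zeros rewrite zeros (suc n) | sumTo-zero n f zeros = refl

count²-zero : ∀ B p → (∀ x y → p x y ≡ false) → count² B p ≡ 0
count²-zero B p none = sumTo-zero B _ (λ x → countTo-zero B (p x) (none x))

countTo-pos : ∀ n p {y} → p y ≡ true → 1 ≤ y → y ≤ n → 0 < countTo n p
countTo-pos zero    p py (s≤s _) ()
countTo-pos (suc n) p {y} py 1≤y y≤1+n with y ≟ suc n
... | yes refl rewrite py = m≤n+m 1 (countTo n p)
... | no y≢1+n = ≤-trans (countTo-pos n p py 1≤y (s≤s⁻¹ (≤∧≢⇒< y≤1+n y≢1+n))) (m≤m+n _ _)

sumTo-≥ : ∀ n f {x} → 1 ≤ x → x ≤ n → f x ≤ sumTo n f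
sumTo-≥ zero    f (s≤s _) ()
sumTo-≥ (suc n) f {x} 1≤x x≤1+n with x ≟ suc n
... | yes refl = m≤n+m _ (sumTo n f)
... | no x≢1+n = ≤-trans (sumTo-≥ n f 1≤x (s≤s⁻¹ (≤∧≢⇒< x≤1+n x≢1+n))) (m≤m+n _ _)

count²-pos : ∀ B p {x y} → p x y ≡ true → 1 ≤ x → x ≤ B → 1 ≤ y → y ≤ B → 0 < count² B p
count²-pos B p pxy 1≤x x≤B 1≤y y≤B =
  ≤-trans (countTo-pos B (p _) pxy 1≤y y≤B) (sumTo-≥ B (λ x → countTo B (p x)) 1≤x x≤B)

indicator-mono : ∀ a b → (a ≡ true → b ≡ true) → indicator a ≤ indicator b
indicator-mono false b a⇒b = z≤n
indicator-mono true  b a⇒b rewrite a⇒b refl = ≤-refl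

countTo-mono : ∀ n p q → (∀ y → p y ≡ true → q y ≡ true) → countTo n p ≤ countTo n q
countTo-mono zero    p q p⊆q = z≤n
countTo-mono (suc n) p q p⊆q =
  +-mono-≤ (countTo-mono n p q p⊆q) (indicator-mono _ _ (p⊆q (suc n)))

sumTo-mono : ∀ n f g → (∀ x → f x ≤ g x) → sumTo n f ≤ sumTo n g
sumTo-mono zero    f g f≤g = z≤n
sumTo-mono (suc n) f g f≤g = +-mono-≤ (sumTo-mono n f g f≤g) (f≤g (suc n))

count²-mono : ∀ B p q → (∀ x y → p x y ≡ true → q x y ≡ true) → count² B p ≤ count² B q
count²-mono B p q p⊆q = sumTo-mono B _ _ (λ x → countTo-mono B (p x) (q x) (p⊆q x))

minUpTo-≤ : ∀ n f {k} → k ≤ n → minUpTo n f ≤ f k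
minUpTo-≤ zero    f z≤n = ≤-refl
minUpTo-≤ (suc n) f {k} k≤1+n with k ≟ suc n
... | yes refl = m⊓n≤n _ _
... | no k≢1+n = ≤-trans (m⊓n≤m _ _) (minUpTo-≤ n f (s≤s⁻¹ (≤∧≢⇒< k≤1+n k≢1+n)))

minUpTo-attained : ∀ n f → Σ ℕ λ k → k ≤ n × minUpTo n f ≡ f k
minUpTo-attained zero    f = 0 , z≤n , refl
minUpTo-attained (suc n) f with ⊓-sel (minUpTo n f) (f (suc n))
... | inj₂ min≡last = suc n , ≤-refl , min≡last
... | inj₁ min≡init with minUpTo-attained n f
...   | k , k≤n , eq = k , m≤n⇒m≤1+n k≤n , trans min≡init eq

minUpTo-mono : ∀ n f g → (∀ k → f k ≤ g k) → minUpTo n f ≤ minUpTo n g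
minUpTo-mono zero    f g f≤g = f≤g 0
minUpTo-mono (suc n) f g f≤g = ⊓-mono-≤ (minUpTo-mono n f g f≤g) (f≤g (suc n))

triangle⇒≤ : ∀ {i j d} → suc i + suc j ≤ suc d + 1 → i + j ≤ d
triangle⇒≤ {i} {j} {d} h = s≤s⁻¹ (subst₂ _≤_ (+-suc i j) (+-comm d 1) (s≤s⁻¹ h))

hypotenuse : ∀ {j d} → j ≤ d → suc (d ∸ j) + suc j ≡ suc d + 1
hypotenuse {j} {d} j≤d = cong suc (begin
  d ∸ j + suc j   ≡⟨ +-suc (d ∸ j) j ⟩
  suc (d ∸ j + j) ≡⟨ cong suc (m∸n+n≡m j≤d) ⟩
  suc d           ≡⟨ +-comm 1 d ⟩
  d + 1           ∎)
  where open ≡-Reasoning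

module _ (D : Ferrers) where
  open IsFerrers (isFerrers D)

  ∉⇒ν≡0 : ∀ {i j d} → mem D (suc i) (suc j) ≡ false → i + j ≤ d → ν D (suc d) j ≡ 0
  ∉⇒ν≡0 {i} {j} {d} ij∉D i+j≤d = count²-zero (bound D) _ (λ x y → ¬-not (undominated x y))
    where
    undominated : ∀ x y → ¬ (mem D x y ∧ ((suc d ∸ j) ≤ᵇ x) ∧ ((j + 1) ≤ᵇ y)) ≡ true
    undominated x y counted = contradiction (trans (sym ij∉D) ij∈D) λ ()
      where
      xy∈D = ∧-conicalˡ (mem D x y) _ counted
      bounds = ∧-conicalʳ (mem D x y) _ counted
      i<x : suc i ≤ x
      i<x = ≤-trans (m+n≤o⇒m≤o∸n (suc i) (s≤s i+j≤d)) (≤ᵇ≡true⇒≤ (∧-conicalˡ _ _ bounds))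
      j<y : suc j ≤ y
      j<y = subst (_≤ y) (+-comm j 1) (≤ᵇ≡true⇒≤ (∧-conicalʳ _ _ bounds))
      ij∈D = downward x y (suc i) (suc j) xy∈D (s≤s z≤n) i<x (s≤s z≤n) j<y

  ∈⇒ν>0 : ∀ {j d} → j ≤ d → mem D (suc (d ∸ j)) (suc j) ≡ true → 0 < ν D (suc d) j
  ∈⇒ν>0 {j} {d} j≤d p∈D =
    count²-pos (bound D) _ counted (s≤s z≤n) (proj₁ p≤B) (s≤s z≤n) (proj₂ p≤B)
    where
    p≤B = bounded _ _ p∈D
    counted : (mem D (suc (d ∸ j)) (suc j) ∧ ((suc d ∸ j) ≤ᵇ suc (d ∸ j)) ∧ ((j + 1) ≤ᵇ suc j)) ≡ true
    counted = cong₂ _∧_ p∈D (cong₂ _∧_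
      (≤⇒≤ᵇ≡true (≤-reflexive (+-∸-assoc 1 j≤d)))
      (≤⇒≤ᵇ≡true (≤-reflexive (+-comm j 1))))

  ∉⇒νmin≡0 : ∀ {i j d} → mem D (suc i) (suc j) ≡ false → i + j ≤ d → νmin D (suc d) ≡ 0
  ∉⇒νmin≡0 {i} {j} {d} ij∉D i+j≤d = n≤0⇒n≡0 (≤-trans
    (minUpTo-≤ d (ν D (suc d)) (m+n≤o⇒n≤o i i+j≤d))
    (≤-reflexive (∉⇒ν≡0 ij∉D i+j≤d)))

  νmin≢0⇒⊇T : ∀ {d} → νmin D (suc d) ≢ 0 → TriangleSub (suc d) D
  νmin≢0⇒⊇T ν≢0 (suc i) (suc j) _ _ ij∈T with mem D (suc i) (suc j) in eq
  ... | true  = refl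
  ... | false = contradiction (∉⇒νmin≡0 eq (triangle⇒≤ ij∈T)) ν≢0

  νmin≡0⇒⊉T : ∀ {d} → νmin D (suc d) ≡ 0 → ¬ TriangleSub (suc d) D
  νmin≡0⇒⊉T {d} ν≡0 T⊆D with minUpTo-attained d (ν D (suc d))
  ... | j , j≤d , min≡νj = >⇒≢ νj>0 (trans (sym min≡νj) ν≡0)
    where
    νj>0 = ∈⇒ν>0 j≤d (T⊆D _ _ (s≤s z≤n) (s≤s z≤n) (≤-reflexive (hypotenuse j≤d)))

  ⊉T⇒νmin≡0 : ∀ {d} → ¬ TriangleSub (suc d) D → νmin D (suc d) ≡ 0
  ⊉T⇒νmin≡0 {d} T⊈D with νmin D (suc d) ≟ 0
  ... | yes ν≡0 = ν≡0
  ... | no  ν≢0 = contradiction (νmin≢0⇒⊇T ν≢0) T⊈D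

without : Pred² → ℕ → ℕ → Pred²
without m r c a b = m a b ∧ not ((a ≡ᵇ r) ∧ (b ≡ᵇ c))

∈-without : ∀ m {r c a b} → m a b ≡ true → (a , b) ≢ (r , c) → without m r c a b ≡ true
∈-without m {r} {c} {a} {b} ab∈m ab≢rc
  rewrite ab∈m with a ≡ᵇ r in a≡r | b ≡ᵇ c in b≡c
... | false | _     = refl
... | true  | false = refl
... | true  | true  = contradiction
  (cong₂ _,_ (≡ᵇ⇒≡ a r (from T-≡ a≡r)) (≡ᵇ⇒≡ b c (from T-≡ b≡c))) ab≢rc

∉-without : ∀ m r c → without m r c r c ≡ false
∉-without m r c rewrite ≡ᵇ-refl r | ≡ᵇ-refl c = ∧-zeroʳ (m r c)

without-∈ : ∀ m {r c a b} → without m r c a b ≡ true → m a b ≡ true × (a , b) ≢ (r , c)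
without-∈ m {r} {c} ab∈ =
  ∧-conicalˡ _ _ ab∈ , λ { refl → contradiction (trans (sym ab∈) (∉-without m r c)) λ () }

IsCorner : Ferrers → ℕ → ℕ → Set
IsCorner D r c = mem D r c ≡ true × mem D (suc r) c ≡ false × mem D r (suc c) ≡ false

module _ (D : Ferrers) {r c : ℕ} (corner : IsCorner D r c) where
  open IsFerrers (isFerrers D)

  private
    rc∈D = proj₁ corner
    r+1c∉D = proj₁ (proj₂ corner)
    rc+1∉D = proj₂ (proj₂ corner)

    without-downward : ∀ a b i j → without (mem D) r c a b ≡ true →
                       1 ≤ i → i ≤ a → 1 ≤ j → j ≤ b → without (mem D) r c i j ≡ true
    without-downward a b i j ab∈ 1≤i i≤a 1≤j j≤b =
      ∈-without (mem D) (downward a b i j ab∈D 1≤i i≤a 1≤j j≤b) ij≢rc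
      where
      ab∈D = proj₁ (without-∈ (mem D) ab∈)
      ij≢rc : (i , j) ≢ (r , c)
      ij≢rc refl with m≤n⇒m<n∨m≡n i≤a | m≤n⇒m<n∨m≡n j≤b
      ... | inj₁ r<a  | _         = not-¬ r+1c∉D (downward a b (suc r) c ab∈D (s≤s z≤n) r<a 1≤j j≤b)
      ... | inj₂ _    | inj₁ c<b  = not-¬ rc+1∉D (downward a b r (suc c) ab∈D 1≤i i≤a (s≤s z≤n) c<b)
      ... | inj₂ refl | inj₂ refl = proj₂ (without-∈ (mem D) ab∈) refl

  removeCorner : Ferrers
  removeCorner = record
    { mem       = without (mem D) r c
    ; bound     = bound D
    ; isFerrers = record
      { positive = λ a b ab∈ → positive a b (proj₁ (without-∈ (mem D) ab∈))
      ; bounded  = λ a b ab∈ → bounded a b (proj₁ (without-∈ (mem D) ab∈))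
      ; downward = without-downward
      }
    }

  removeCorner-isRemoval : IsRemoval removeCorner D r c
  removeCorner-isRemoval = rc∈D , λ a b → refl

  νmin-removeCorner-≤ : ∀ d → νmin removeCorner d ≤ νmin D d
  νmin-removeCorner-≤ d = minUpTo-mono (d ∸ 1) _ _ λ j → count²-mono (bound D) _ _ λ a b counted →
    cong₂ _∧_ (proj₁ (without-∈ (mem D) (∧-conicalˡ (without (mem D) r c a b) _ counted)))
              (∧-conicalʳ (without (mem D) r c a b) _ counted)

lastTrue : ℕ → (ℕ → Bool) → ℕ
lastTrue zero    p = 0
lastTrue (suc n) p with p (suc n)
... | true  = suc n
... | false = lastTrue n p

true-below-false : ∀ (p : ℕ → Bool) {n k} → p k ≡ true → p (suc n) ≡ false → k ≤ suc n → k ≤ n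
true-below-false p pk p1+n k≤1+n with m≤n⇒m<n∨m≡n k≤1+n
... | inj₁ k<1+n = s≤s⁻¹ k<1+n
... | inj₂ refl  = contradiction pk (not-¬ p1+n)

lastTrue-true : ∀ n (p : ℕ → Bool) {k} → p k ≡ true → k ≤ n → p (lastTrue n p) ≡ true
lastTrue-true zero    p pk z≤n = pk
lastTrue-true (suc n) p pk k≤1+n with p (suc n) in p1+n
... | true  = p1+n
... | false = lastTrue-true n p pk (true-below-false p pk p1+n k≤1+n)

lastTrue-greatest : ∀ n (p : ℕ → Bool) {k} → p k ≡ true → k ≤ n → k ≤ lastTrue n p
lastTrue-greatest zero    p pk k≤0 = k≤0
lastTrue-greatest (suc n) p pk k≤1+n with p (suc n) in p1+n
... | true  = k≤1+n
... | false = lastTrue-greatest n p pk (true-below-false p pk p1+n k≤1+n)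

-- r is the last row of D and c the last column of row r.
corner-of : (D : Ferrers) → NonEmpty D → Σ ℕ λ r → Σ ℕ λ c → IsCorner D r c
corner-of D (x , y , xy∈D) = r , c , rc∈D , r+1c∉D , rc+1∉D
  where
  open IsFerrers (isFerrers D)
  B = bound D
  inColumn1 : ℕ → Bool
  inColumn1 a = mem D a 1
  x1∈D : mem D x 1 ≡ true
  x1∈D = downward x y x 1 xy∈D (proj₁ (positive x y xy∈D)) ≤-refl (s≤s z≤n) (proj₂ (positive x y xy∈D))
  r = lastTrue B inColumn1
  r1∈D = lastTrue-true B inColumn1 x1∈D (proj₁ (bounded x y xy∈D))
  c = lastTrue B (mem D r)
  rc∈D = lastTrue-true B (mem D r) r1∈D (proj₂ (bounded r 1 r1∈D))
  r+1c∉D : mem D (suc r) c ≡ false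
  r+1c∉D = ¬-not λ r+1c∈D → 1+n≰n (lastTrue-greatest B inColumn1
    (downward (suc r) c (suc r) 1 r+1c∈D (s≤s z≤n) ≤-refl (s≤s z≤n) (proj₂ (positive r c rc∈D)))
    (proj₁ (bounded (suc r) c r+1c∈D)))
  rc+1∉D : mem D r (suc c) ≡ false
  rc+1∉D = ¬-not λ rc+1∈D → 1+n≰n (lastTrue-greatest B (mem D r) rc+1∈D (proj₂ (bounded r (suc c) rc+1∈D)))

νmin≡0⇒reducible : (D : Ferrers) (d : ℕ) → NonEmpty D → νmin D d ≡ 0 → Σ Ferrers λ D' → Arrow d D' D
νmin≡0⇒reducible D d nonempty ν≡0 with corner-of D nonempty
... | r , c , corner = removeCorner D corner , r , c , removeCorner-isRemoval D corner ,
  trans (n≤0⇒n≡0 (≤-trans (νmin-removeCorner-≤ D corner d) (≤-reflexive ν≡0))) (sym ν≡0)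

lemma4p17 : (D : Ferrers) (d : ℕ) → 1 ≤ d →
    ((νmin D d ≡ 0) ⇔ (¬ TriangleSub d D)) ×
    (NonEmpty D → Irreducible D d → TriangleSub d D)
lemma4p17 D (suc d) _ =
  mk⇔ (νmin≡0⇒⊉T D) (⊉T⇒νmin≡0 D) ,
  λ nonempty irreducible → νmin≢0⇒⊇T D λ ν≡0 → irreducible (νmin≡0⇒reducible D (suc d) nonempty ν≡0)
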